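{- Let $k\ge0$ and let $P,Q$ be finite ordered sets with equal marked rank $k$ decks. Suppose that $|P_k|>1$ and $|Q_k|>1$; that no two elements of rank $k$ have the same sets of strict upper bounds and the same sets of strict lower bounds, in either $P$ or $Q$; and that $P\setminus P_k$ and $Q\setminus Q_k$ are both rigid. Then $P$ is isomorphic to $Q$.
   Context: Rank of $x$: length (number of elements minus one) of the longest chain from a minimal element up to $x$. $P_k=\{x\in P:\mathrm{rank}(x)=k\}$. Subsets carry the induced order. Rigid: the only automorphism is the identity. Marked rank $k$ decks of $P$ and $Q$ are equal if there is a bijection between the multisets $\{P\setminus\{x\}:x\in P_k\}$ and $\{Q\setminus\{y\}:y\in Q_k\}$ such that each card is isomorphic to its image via an isomorphism preserving the rank each element had in the original set. -}

module Defs where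

open import Data.Nat using (ℕ; zero; suc; _≤_; _>_)
open import Data.Fin using (Fin)
open import Data.Product using (Σ; _×_; _,_)
open import Data.Unit using (⊤)
open import Relation.Nullary using (¬_)
open import Relation.Binary.Structures using (IsDecPartialOrder)
open import Relation.Binary.PropositionalEquality using (_≡_; _≢_)
open import Function.Bundles using (_⇔_)

record FinPoset : Set₁ where
  field
    n    : ℕ
    _≼_  : Fin n → Fin n → Set
    isDecPartialOrder : IsDecPartialOrder _≡_ _≼_

open FinPoset public

Elem : FinPoset → Set
Elem P = Fin (n P)

Lt : (P : FinPoset) → Elem P → Elem P → Set
Lt P a b = _≼_ P a b × a ≢ b

Minimal : (P : FinPoset) → Elem P → Set
Minimal P x = ∀ z → _≼_ P z x → z ≡ x

data ChainTo (P : FinPoset) : Elem P → ℕ → Set where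
  start : ∀ {x} → Minimal P x → ChainTo P x zero
  step  : ∀ {y x k} → ChainTo P y k → Lt P y x → ChainTo P x (suc k)

HasRank : (P : FinPoset) → Elem P → ℕ → Set
HasRank P x k = ChainTo P x k × (∀ m → ChainTo P x m → m ≤ k)

-- An isomorphism between the induced suborders on S ⊆ P and T ⊆ Q.
-- Encoded by total maps on the carriers which restrict to mutually inverse
-- maps S → T and T → S preserving and reflecting the order; values outside
-- S (resp. T) are irrelevant.
record SubIso (P Q : FinPoset) (S : Elem P → Set) (T : Elem Q → Set) : Set where
  field
    to      : Elem P → Elem Q
    from    : Elem Q → Elem P
    to-∈    : ∀ {a} → S a → T (to a)
    from-∈  : ∀ {b} → T b → S (from b)
    from-to : ∀ {a} → S a → from (to a) ≡ a
    to-from : ∀ {b} → T b → to (from b) ≡ b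
    order   : ∀ {a b} → S a → S b → (_≼_ P a b ⇔ _≼_ Q (to a) (to b))

_≅_ : FinPoset → FinPoset → Set
P ≅ Q = SubIso P Q (λ _ → ⊤) (λ _ → ⊤)

record MarkedCardIso (P Q : FinPoset) (x : Elem P) (y : Elem Q) : Set where
  field
    iso : SubIso P Q (λ a → a ≢ x) (λ b → b ≢ y)
  open SubIso iso
  field
    rank-pres : ∀ {a} → a ≢ x → ∀ j → (HasRank P a j ⇔ HasRank Q (to a) j)

-- Equal marked rank k decks: a bijection σ : P_k → Q_k of the (indexing sets of
-- the) multisets of cards with P ∖ {x} ≅ Q ∖ {σ x} rank-preservingly.
record EqualMarkedRankDecks (k : ℕ) (P Q : FinPoset) : Set where
  field
    σ       : Elem P → Elem Q
    τ       : Elem Q → Elem P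
    σ-∈     : ∀ {x} → HasRank P x k → HasRank Q (σ x) k
    τ-∈     : ∀ {y} → HasRank Q y k → HasRank P (τ y) k
    τ-σ     : ∀ {x} → HasRank P x k → τ (σ x) ≡ x
    σ-τ     : ∀ {y} → HasRank Q y k → σ (τ y) ≡ y
    cards   : ∀ {x} → HasRank P x k → MarkedCardIso P Q x (σ x)

AtLeastTwoOfRank : ℕ → FinPoset → Set
AtLeastTwoOfRank k P = Σ (Elem P) λ x → Σ (Elem P) λ y → HasRank P x k × HasRank P y k × x ≢ y

RankDistinguished : ℕ → FinPoset → Set
RankDistinguished k P = ∀ x y → HasRank P x k → HasRank P y k →
  (∀ z → (Lt P x z ⇔ Lt P y z)) → (∀ z → (Lt P z x ⇔ Lt P z y)) → x ≡ y

RigidWithoutRank : ℕ → FinPoset → Set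
RigidWithoutRank k P = (f : SubIso P P (λ a → ¬ HasRank P a k) (λ a → ¬ HasRank P a k)) →
  ∀ a → ¬ HasRank P a k → SubIso.to f a ≡ a

{-# OPTIONS --safe #-}
-- For x of rank k let φₓ : P ∖ {x} ≅ Q ∖ {σ x} be its card isomorphism. For two
-- rank-k elements x, x', φₓ'⁻¹ ∘ φₓ restricts to an automorphism of P ∖ P_k, so by
-- rigidity all φₓ agree off rank k. Elements of equal rank are incomparable, so by
-- the distinctness hypothesis a rank-k element is determined, among rank-k elements,
-- by its comparabilities with P ∖ P_k. Hence φₓ' sends x to σ x: otherwise φₓ⁻¹ (φₓ' x) would be a second rank-k
-- element with the same comparabilities as x. So x is placed relative to P ∖ P_k
-- exactly as σ x is relative to Q ∖ Q_k, and φₓ extended by x ↦ σ x is P ≅ Q.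
module Submission where

open import Defs
open import Data.Nat using (ℕ)
open import Data.Nat.Properties using (1+n≰n)
open import Data.Fin using (_≟_)
open import Data.Product using (_×_; _,_; Σ-syntax)
open import Data.Unit using (tt)
open import Data.Vec.Functional using (updateAt)
open import Data.Vec.Functional.Properties using (updateAt-updates; updateAt-minimal)
open import Function.Base using (_∘_; const)
open import Function.Bundles using (_⇔_; mk⇔; module Equivalence)
import Function.Properties.Equivalence as ⇔
open import Level using (0ℓ)
open import Relation.Nullary using (¬_; yes; no; contradiction)
open import Relation.Unary using (_⊆_)
open import Relation.Binary.PropositionalEquality
  using (_≡_; _≢_; refl; sym; trans; cong; cong₂; subst; subst₂; module ≡-Reasoning)
open import Relation.Binary.Structures using (IsDecPartialOrder)
import Relation.Binary.Reasoning.Setoid as SetoidReasoning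

module ⇔-Reasoning = SetoidReasoning (⇔.⇔-setoid 0ℓ)

private
  variable
    k : ℕ
    P Q R : FinPoset

OffRank : ℕ → (P : FinPoset) → Elem P → Set
OffRank k P a = ¬ HasRank P a k

≼-refl : (P : FinPoset) {a : Elem P} → _≼_ P a a
≼-refl P = IsDecPartialOrder.refl (isDecPartialOrder P)

same-rank⇒¬Lt : (P : FinPoset) {a b : Elem P} →
  HasRank P a k → HasRank P b k → ¬ Lt P a b
same-rank⇒¬Lt P (chain-a , _) (_ , longest-b) a<b = 1+n≰n (longest-b _ (step chain-a a<b))

OffRank⇒≢ : {x a : Elem P} → HasRank P x k → OffRank k P a → a ≢ x
OffRank⇒≢ rx a-off refl = a-off rx

another-of-rank : AtLeastTwoOfRank k P →
  ∀ {x} → HasRank P x k → Σ[ x' ∈ Elem P ] HasRank P x' k × x ≢ x'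
another-of-rank (x₁ , x₂ , r₁ , r₂ , x₁≢x₂) {x} rx with x₁ ≟ x
... | yes refl = x₂ , r₂ , x₁≢x₂
... | no x₁≢x = x₁ , r₁ , x₁≢x ∘ sym

strict-upper-transfer : {x z : Elem P} → HasRank P x k → HasRank P z k →
  (∀ {c} → OffRank k P c → _≼_ P x c → _≼_ P z c) → ∀ {c} → Lt P x c → Lt P z c
strict-upper-transfer {P = P} rx rz h (x≼c , x≢c) = h c-off x≼c , λ { refl → c-off rz }
  where c-off = λ rc → same-rank⇒¬Lt P rx rc (x≼c , x≢c)

strict-lower-transfer : {x z : Elem P} → HasRank P x k → HasRank P z k →
  (∀ {c} → OffRank k P c → _≼_ P c x → _≼_ P c z) → ∀ {c} → Lt P c x → Lt P c z
strict-lower-transfer {P = P} rx rz h (c≼x , c≢x) = h c-off c≼x , λ { refl → c-off rz }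
  where c-off = λ rc → same-rank⇒¬Lt P rc rx (c≼x , c≢x)

module _ {P : FinPoset} {x z : Elem P} (rx : HasRank P x k) (rz : HasRank P z k) where

  same-strict-upper-bounds : (∀ {c} → OffRank k P c → _≼_ P x c ⇔ _≼_ P z c) →
    ∀ c → Lt P x c ⇔ Lt P z c
  same-strict-upper-bounds h _ = mk⇔
    (strict-upper-transfer rx rz (Equivalence.to ∘ h))
    (strict-upper-transfer rz rx (Equivalence.from ∘ h))

  same-strict-lower-bounds : (∀ {c} → OffRank k P c → _≼_ P c x ⇔ _≼_ P c z) →
    ∀ c → Lt P c x ⇔ Lt P c z
  same-strict-lower-bounds h _ = mk⇔
    (strict-lower-transfer rx rz (Equivalence.to ∘ h))
    (strict-lower-transfer rz rx (Equivalence.from ∘ h))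

module _ {S : Elem P → Set} {T : Elem Q → Set} (f : SubIso P Q S T) where
  open SubIso f

  SubIso-sym : SubIso Q P T S
  SubIso-sym = record
    { to = from ; from = to ; to-∈ = from-∈ ; from-∈ = to-∈
    ; from-to = to-from ; to-from = from-to
    ; order = λ {b} {b'} tb tb' → ⇔.sym
        (subst₂ (λ u v → _≼_ P (from b) (from b') ⇔ _≼_ Q u v) (to-from tb) (to-from tb')
          (order (from-∈ tb) (from-∈ tb')))
    }

  SubIso-restrict : {S' : Elem P → Set} {T' : Elem Q → Set} → S' ⊆ S → T' ⊆ T →
    (∀ {a} → S' a → T' (to a)) → (∀ {b} → T' b → S' (from b)) → SubIso P Q S' T'
  SubIso-restrict S'⊆S T'⊆T to-∈' from-∈' = record
    { to = to ; from = from ; to-∈ = to-∈' ; from-∈ = from-∈'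
    ; from-to = from-to ∘ S'⊆S ; to-from = to-from ∘ T'⊆T
    ; order = λ sa sb → order (S'⊆S sa) (S'⊆S sb)
    }

SubIso-trans : {S : Elem P → Set} {T : Elem Q → Set} {U : Elem R → Set} →
  SubIso P Q S T → SubIso Q R T U → SubIso P R S U
SubIso-trans f g = record
  { to = G.to ∘ F.to ; from = F.from ∘ G.from
  ; to-∈ = G.to-∈ ∘ F.to-∈ ; from-∈ = F.from-∈ ∘ G.from-∈
  ; from-to = λ sa → trans (cong F.from (G.from-to (F.to-∈ sa))) (F.from-to sa)
  ; to-from = λ ub → trans (cong G.to (F.to-from (G.from-∈ ub))) (G.to-from ub)
  ; order = λ sa sb → ⇔.trans (F.order sa sb) (G.order (F.to-∈ sa) (F.to-∈ sb))
  }
  where module F = SubIso f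
        module G = SubIso g

extend-to : {x : Elem P} {y : Elem Q} → SubIso P Q (_≢ x) (_≢ y) → Elem P → Elem Q
extend-to {x = x} {y = y} f = updateAt (SubIso.to f) x (const y)

module _ {x : Elem P} {y : Elem Q} (f : SubIso P Q (_≢ x) (_≢ y)) where
  open SubIso f

  extend-to-off : ∀ {a} → a ≢ x → extend-to f a ≡ to a
  extend-to-off {a} a≢x = updateAt-minimal a x to a≢x

  extend-to-from : ∀ b → extend-to f (extend-to (SubIso-sym f) b) ≡ b
  extend-to-from b with b ≟ y
  ... | yes refl = trans (cong (extend-to f) (updateAt-updates y from)) (updateAt-updates x to)
  ... | no b≢y = begin
      extend-to f (extend-to (SubIso-sym f) b) ≡⟨ cong (extend-to f) (updateAt-minimal b y from b≢y) ⟩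
      extend-to f (from b)                     ≡⟨ extend-to-off (from-∈ b≢y) ⟩
      to (from b)                              ≡⟨ to-from b≢y ⟩
      b                                        ∎
    where open ≡-Reasoning

  extend-order :
    (∀ {c} → c ≢ x → _≼_ P x c ⇔ _≼_ Q y (to c)) →
    (∀ {c} → c ≢ x → _≼_ P c x ⇔ _≼_ Q (to c) y) →
    ∀ a b → _≼_ P a b ⇔ _≼_ Q (extend-to f a) (extend-to f b)
  extend-order upper lower a b with a ≟ x | b ≟ x
  ... | yes refl | yes refl = mk⇔ (λ _ → ≼-refl Q) (λ _ → ≼-refl P)
  ... | yes refl | no b≢x = subst₂ (λ u v → _≼_ P x b ⇔ _≼_ Q u v)
        (sym (updateAt-updates x to)) (sym (extend-to-off b≢x)) (upper b≢x)
  ... | no a≢x | yes refl = subst₂ (λ u v → _≼_ P a x ⇔ _≼_ Q u v)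
        (sym (extend-to-off a≢x)) (sym (updateAt-updates x to)) (lower a≢x)
  ... | no a≢x | no b≢x = subst₂ (λ u v → _≼_ P a b ⇔ _≼_ Q u v)
        (sym (extend-to-off a≢x)) (sym (extend-to-off b≢x)) (order a≢x b≢x)

extend : {x : Elem P} {y : Elem Q} (f : SubIso P Q (_≢ x) (_≢ y)) →
  (∀ {c} → c ≢ x → _≼_ P x c ⇔ _≼_ Q y (SubIso.to f c)) →
  (∀ {c} → c ≢ x → _≼_ P c x ⇔ _≼_ Q (SubIso.to f c) y) → P ≅ Q
extend f upper lower = record
  { to = extend-to f ; from = extend-to (SubIso-sym f)
  ; to-∈ = λ _ → tt ; from-∈ = λ _ → tt
  ; from-to = λ {a} _ → extend-to-from (SubIso-sym f) a
  ; to-from = λ {b} _ → extend-to-from f b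
  ; order = λ {a} {b} _ _ → extend-order f upper lower a b
  }

MarkedCardIso-sym : {x : Elem P} {y : Elem Q} → MarkedCardIso P Q x y → MarkedCardIso Q P y x
MarkedCardIso-sym {P = P} {Q = Q} card = record
  { iso = SubIso-sym iso
  ; rank-pres = λ {b} b≢y j → ⇔.sym
      (subst (λ b' → HasRank P (from b) j ⇔ HasRank Q b' j) (to-from b≢y)
        (rank-pres (from-∈ b≢y) j))
  }
  where open MarkedCardIso card
        open SubIso iso

to-OffRank : {x : Elem P} {y : Elem Q} (card : MarkedCardIso P Q x y) → HasRank P x k →
  ∀ {a} → OffRank k P a → OffRank k Q (SubIso.to (MarkedCardIso.iso card) a)
to-OffRank card rx a-off =
  a-off ∘ Equivalence.from (MarkedCardIso.rank-pres card (OffRank⇒≢ rx a-off) _)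

OffRank-iso : {x : Elem P} {y : Elem Q} → MarkedCardIso P Q x y →
  HasRank P x k → HasRank Q y k → SubIso P Q (OffRank k P) (OffRank k Q)
OffRank-iso card rx ry = SubIso-restrict (MarkedCardIso.iso card) (OffRank⇒≢ rx) (OffRank⇒≢ ry)
  (to-OffRank card rx) (to-OffRank (MarkedCardIso-sym card) ry)

module _ {x : Elem P} {y : Elem Q} (card : MarkedCardIso P Q x y) where
  open MarkedCardIso card
  open SubIso iso

  upper-from-OffRank : HasRank P x k → HasRank Q y k →
    (∀ {c} → OffRank k P c → _≼_ P x c ⇔ _≼_ Q y (to c)) →
    ∀ {c} → c ≢ x → _≼_ P x c ⇔ _≼_ Q y (to c)
  upper-from-OffRank rx ry h c≢x = mk⇔
    (λ x≼c → Equivalence.to (h (λ rc → same-rank⇒¬Lt P rx rc (x≼c , c≢x ∘ sym))) x≼c)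
    (λ y≼φc → Equivalence.from (h (λ rc → same-rank⇒¬Lt Q ry
      (Equivalence.to (rank-pres c≢x _) rc) (y≼φc , to-∈ c≢x ∘ sym))) y≼φc)

  lower-from-OffRank : HasRank P x k → HasRank Q y k →
    (∀ {c} → OffRank k P c → _≼_ P c x ⇔ _≼_ Q (to c) y) →
    ∀ {c} → c ≢ x → _≼_ P c x ⇔ _≼_ Q (to c) y
  lower-from-OffRank rx ry h c≢x = mk⇔
    (λ c≼x → Equivalence.to (h (λ rc → same-rank⇒¬Lt P rc rx (c≼x , c≢x))) c≼x)
    (λ φc≼y → Equivalence.from (h (λ rc → same-rank⇒¬Lt Q
      (Equivalence.to (rank-pres c≢x _) rc) ry (φc≼y , to-∈ c≢x))) φc≼y)

module _ {P Q : FinPoset} (D : EqualMarkedRankDecks k P Q) (rigid : RigidWithoutRank k P) where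
  open EqualMarkedRankDecks D

  card : ∀ {x} → HasRank P x k → SubIso P Q (_≢ x) (_≢ σ x)
  card rx = MarkedCardIso.iso (cards rx)

  φ : ∀ {x} → HasRank P x k → Elem P → Elem Q
  φ rx = SubIso.to (card rx)

  cards-agree-OffRank : ∀ {x x'} (rx : HasRank P x k) (rx' : HasRank P x' k) →
    ∀ {c} → OffRank k P c → φ rx c ≡ φ rx' c
  cards-agree-OffRank rx rx' {c} c-off = begin
      φ rx c                            ≡⟨ SubIso.to-from ι' (SubIso.to-∈ ι c-off) ⟨
      φ rx' (SubIso.from ι' (φ rx c))   ≡⟨ cong (φ rx') (rigid (SubIso-trans ι (SubIso-sym ι')) c c-off) ⟩
      φ rx' c                           ∎
    where
      open ≡-Reasoning
      ι = OffRank-iso (cards rx) rx (σ-∈ rx)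
      ι' = OffRank-iso (cards rx') rx' (σ-∈ rx')

  module _ (distinguished : RankDistinguished k P) {x x' : Elem P}
           (rx : HasRank P x k) (rx' : HasRank P x' k) (x≢x' : x ≢ x') where

    other-card-sends-to-mark : φ rx' x ≡ σ x
    other-card-sends-to-mark with φ rx' x ≟ σ x
    ... | yes φ'x≡σx = φ'x≡σx
    ... | no φ'x≢σx = contradiction
        (distinguished x z rx rz (same-strict-upper-bounds rx rz upper) (same-strict-lower-bounds rx rz lower))
        (z≢x ∘ sym)
      where
        open SubIso (card rx) using (from; from-∈; to-from; order)
        z = from (φ rx' x)
        z≢x = from-∈ φ'x≢σx
        φz≡φ'x : φ rx z ≡ φ rx' x
        φz≡φ'x = to-from φ'x≢σx
        rz : HasRank P z k
        rz = Equivalence.from (MarkedCardIso.rank-pres (cards rx) z≢x k)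
          (subst (λ b → HasRank Q b k) (sym φz≡φ'x)
            (Equivalence.to (MarkedCardIso.rank-pres (cards rx') x≢x' k) rx))
        upper : ∀ {c} → OffRank k P c → _≼_ P x c ⇔ _≼_ P z c
        upper {c} c-off = begin
          _≼_ P x c                  ≈⟨ SubIso.order (card rx') x≢x' (OffRank⇒≢ rx' c-off) ⟩
          _≼_ Q (φ rx' x) (φ rx' c)  ≡⟨ cong₂ (_≼_ Q) (sym φz≡φ'x) (sym (cards-agree-OffRank rx rx' c-off)) ⟩
          _≼_ Q (φ rx z) (φ rx c)    ≈⟨ order z≢x (OffRank⇒≢ rx c-off) ⟨
          _≼_ P z c                  ∎
          where open ⇔-Reasoning
        lower : ∀ {c} → OffRank k P c → _≼_ P c x ⇔ _≼_ P c z
        lower {c} c-off = begin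
          _≼_ P c x                  ≈⟨ SubIso.order (card rx') (OffRank⇒≢ rx' c-off) x≢x' ⟩
          _≼_ Q (φ rx' c) (φ rx' x)  ≡⟨ cong₂ (_≼_ Q) (sym (cards-agree-OffRank rx rx' c-off)) (sym φz≡φ'x) ⟩
          _≼_ Q (φ rx c) (φ rx z)    ≈⟨ order (OffRank⇒≢ rx c-off) z≢x ⟨
          _≼_ P c z                  ∎
          where open ⇔-Reasoning

    mark-upper : ∀ {c} → OffRank k P c → _≼_ P x c ⇔ _≼_ Q (σ x) (φ rx c)
    mark-upper {c} c-off = begin
      _≼_ P x c                  ≈⟨ SubIso.order (card rx') x≢x' (OffRank⇒≢ rx' c-off) ⟩
      _≼_ Q (φ rx' x) (φ rx' c)  ≡⟨ cong₂ (_≼_ Q) other-card-sends-to-mark (sym (cards-agree-OffRank rx rx' c-off)) ⟩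
      _≼_ Q (σ x) (φ rx c)       ∎
      where open ⇔-Reasoning

    mark-lower : ∀ {c} → OffRank k P c → _≼_ P c x ⇔ _≼_ Q (φ rx c) (σ x)
    mark-lower {c} c-off = begin
      _≼_ P c x                  ≈⟨ SubIso.order (card rx') (OffRank⇒≢ rx' c-off) x≢x' ⟩
      _≼_ Q (φ rx' c) (φ rx' x)  ≡⟨ cong₂ (_≼_ Q) (sym (cards-agree-OffRank rx rx' c-off)) other-card-sends-to-mark ⟩
      _≼_ Q (φ rx c) (σ x)       ∎
      where open ⇔-Reasoning

    card-extends-to-iso : P ≅ Q
    card-extends-to-iso = extend (card rx)
      (upper-from-OffRank (cards rx) rx (σ-∈ rx) mark-upper)
      (lower-from-OffRank (cards rx) rx (σ-∈ rx) mark-lower)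

-- The hypotheses on Q are unused: the isomorphism is assembled from a single card of P.
proposition6p1 : (k : ℕ) (P Q : FinPoset) →
    EqualMarkedRankDecks k P Q →
    AtLeastTwoOfRank k P → AtLeastTwoOfRank k Q →
    RankDistinguished k P → RankDistinguished k Q →
    RigidWithoutRank k P → RigidWithoutRank k Q →
    P ≅ Q
proposition6p1 k P Q D two@(x , _ , rx , _) _ distinguished _ rigid _
  with another-of-rank two rx
... | x' , rx' , x≢x' = card-extends-to-iso D rigid distinguished rx rx' x≢x'
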